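{- Let $(s_n)_{n\ge 0}$ be a sequence over $\mathbb{F}_2$ whose generating function $G(x)=\sum_{n\ge 0}s_nx^n\in\mathbb{F}_2[[x]]$ satisfies $h(x,G(x))=0$ for a polynomial $h(x,y)\in\mathbb{F}_2[x,y]$. (i) If $h$ has the form \[ h(x,y)=f_2\big(y^{2^\ell}\big)+x\,f_1(y^2)+y+f_0(x) \] with polynomials $f_0,f_1,f_2$ over $\mathbb{F}_2$, $\deg f_0\le 2^\ell-3$, and an integer $\ell\ge 2$, then for every $N\ge 1$ \[ W(s_n,N)\ge \left\lfloor \frac{N+1}{2^\ell}\right\rfloor . \] (ii) If $h$ has the form \[ h(x,y)=f_1(x^2,y^2)+\big(x^{2^\ell}+1\big)y+f_0(x) \] with polynomials $f_1\in\mathbb{F}_2[x,y]$, $f_0\in\mathbb{F}_2[x]$, $\deg f_0\le 2^\ell-2$, and an integer $\ell\ge 1$, then for every $N\ge 1$ \[ W(s_n,N)\ge \left\lfloor \frac{N}{2^\ell}\right\rfloor . \]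
   Context: For a binary sequence $(s_n)$ (elements of $\mathbb{F}_2=\{0,1\}$, viewed as integers in exponents of $-1$), the $N$th well-distribution measure is \[ W(s_n,N)=\max_{a,b,t}\left|\sum_{j=0}^{t-1}(-1)^{s_{a+jb}}\right|, \] where the maximum is taken over all positive integers $b,t$ and integers $a\ge 0$ with $0\le a\le a+(t-1)b<N$. -}

module Defs where

open import Data.Bool using (Bool; true; false; _xor_; _∧_; if_then_else_)
open import Data.Nat using (ℕ; zero; suc; _+_; _*_; _∸_; _^_; _⊔_; _<ᵇ_; _≡ᵇ_)
open import Data.Nat.DivMod using (_/_)
open import Data.Nat.Properties using (m^n≢0)
open import Data.Integer as ℤ using (ℤ; ∣_∣)
open import Data.List using (List; []; _∷_)

-- Formal power series over F₂ = Bool (false = 0, true = 1, xor = +)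

Series : Set
Series = ℕ → Bool

zeroS : Series
zeroS _ = false

constS : Bool → Series
constS c zero    = c
constS c (suc _) = false

X : Series
X n = n ≡ᵇ 1

_⊕_ : Series → Series → Series
(f ⊕ g) n = f n xor g n
infixl 6 _⊕_

xorUpTo : (ℕ → Bool) → ℕ → Bool
xorUpTo f zero    = f zero
xorUpTo f (suc n) = xorUpTo f n xor f (suc n)

_⊛_ : Series → Series → Series
(f ⊛ g) n = xorUpTo (λ i → f i ∧ g (n ∸ i)) n
infixl 7 _⊛_

powS : Series → ℕ → Series
powS f zero    = constS true
powS f (suc k) = f ⊛ powS f k

-- Polynomials over F₂ as coefficient lists (constant term first)

polyS : List Bool → Series
polyS []       = zeroS
polyS (c ∷ cs) = constS c ⊕ X ⊛ polyS cs

evalPoly : List Bool → Series → Series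
evalPoly []       S = zeroS
evalPoly (c ∷ cs) S = constS c ⊕ S ⊛ evalPoly cs S

-- bivariate polynomial f(x,y) = Σ_i x^i (Σ_j c_ij y^j), row i = coefficients in y
-- substitution f(A,B)
evalPoly2 : List (List Bool) → Series → Series → Series
evalPoly2 []       A B = zeroS
evalPoly2 (r ∷ rs) A B = evalPoly r B ⊕ A ⊛ evalPoly2 rs A B

sgn : Bool → ℤ
sgn false = ℤ.+ 1
sgn true  = ℤ.- (ℤ.+ 1)

corr : (ℕ → Bool) → ℕ → ℕ → ℕ → ℤ
corr s a b zero    = ℤ.+ 0
corr s a b (suc t) = corr s a b t ℤ.+ sgn (s (a + t * b))

maxBelow : ℕ → (ℕ → ℕ) → ℕ
maxBelow zero    f = 0
maxBelow (suc n) f = f n ⊔ maxBelow n f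

-- W(s,N) = max over b,t ≥ 1, a ≥ 0 with a+(t-1)b < N of |corr|.
-- Here a < N, t ∈ [1,N] and b ∈ [1,N]; b > N only permits t = 1,
-- whose value |±1| = 1 is already attained with b = 1, so the max is unchanged.
W : (ℕ → Bool) → ℕ → ℕ
W s N = maxBelow N λ a → maxBelow N λ b' → maxBelow N λ t' →
  if a + t' * suc b' <ᵇ N then ∣ corr s a (suc b') (suc t') ∣ else 0

_/2^_ : ℕ → ℕ → ℕ
m /2^ ℓ = _/_ m (2 ^ ℓ) {{m^n≢0 2 ℓ}}

-- Over F₂ squaring is additive, so G(x)^(2^k) = G(x^(2^k)) only has coefficients at multiples
-- of 2^k, and so has any polynomial in it.  Reading the equation h(x, G(x)) = 0 at the indices
-- n ≡ -2 (mod 2^ℓ) in case (i), resp. n ≡ -1 (mod 2^ℓ) in case (ii), every term but s_n resp.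
-- s_n + s_(n-2^ℓ) vanishes (the f₀-term by the degree bound).  Hence s vanishes on the whole
-- progression -2 + 2^ℓ ℕ, resp. -1 + 2^ℓ ℕ (in (ii) by induction from s_(2^ℓ-1) = 0), and the
-- longest piece of it inside [0, N) is a constant-sign progression of the claimed length.
module Submission where

open import Defs
open import Algebra.Bundles using (CommutativeRing)
open import Data.Bool using (Bool; true; false; _xor_; _∧_; T; if_then_else_)
open import Data.Bool.Properties
  using (xor-assoc; xor-comm; xor-identityʳ; xor-same; ∧-assoc; ∧-comm; ∧-idem; ∧-zeroʳ;
         ∧-distribˡ-xor; ∧-distribʳ-xor; xor-∧-commutativeRing)
open import Data.Integer as ℤ using (ℤ)
open import Data.List using (List; []; _∷_; length)
open import Data.Nat using (ℕ; zero; suc; _+_; _*_; _∸_; _^_; _≤_; _<_; z≤n; s≤s; z<s)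
open import Data.Nat.DivMod using (m/n*n≤m)
open import Data.Nat.Divisibility
  using (_∣_; _∣?_; _∣0; ∣-refl; ∣-trans; 1∣_; ∣⇒≤; n∣m*n; m∣m*n; *-monoʳ-∣; ∣m+n∣m⇒∣n; ∣m∣n⇒∣m+n)
open import Data.Nat.Properties
open import Data.Nat.Tactic.RingSolver using (solve-∀)
open import Data.Product using (_×_; _,_; ∃-syntax)
open import Data.Sum using (_⊎_; inj₁; inj₂)
open import Function using (_∘_)
open import Relation.Nullary using (¬_; yes; no; contradiction)
open import Relation.Nullary.Decidable using (from-no)
open import Relation.Binary.PropositionalEquality

open import Algebra.Properties.CommutativeSemigroup
  (CommutativeRing.+-commutativeSemigroup xor-∧-commutativeRing) using (interchange)

xorUpTo-cong : ∀ {f g : ℕ → Bool} n → (∀ i → i ≤ n → f i ≡ g i) → xorUpTo f n ≡ xorUpTo g n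
xorUpTo-cong zero    f≗g = f≗g 0 z≤n
xorUpTo-cong (suc n) f≗g =
  cong₂ _xor_ (xorUpTo-cong n (λ i i≤n → f≗g i (m≤n⇒m≤1+n i≤n))) (f≗g (suc n) ≤-refl)

xorUpTo-false : ∀ {f : ℕ → Bool} n → (∀ i → i ≤ n → f i ≡ false) → xorUpTo f n ≡ false
xorUpTo-false zero    f≡0 = f≡0 0 z≤n
xorUpTo-false (suc n) f≡0 =
  cong₂ _xor_ (xorUpTo-false n (λ i i≤n → f≡0 i (m≤n⇒m≤1+n i≤n))) (f≡0 (suc n) ≤-refl)

xorUpTo-xor : ∀ (f g : ℕ → Bool) n →
              xorUpTo (λ i → f i xor g i) n ≡ xorUpTo f n xor xorUpTo g n
xorUpTo-xor f g zero    = refl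
xorUpTo-xor f g (suc n) =
  trans (cong (_xor (f (suc n) xor g (suc n))) (xorUpTo-xor f g n))
        (interchange (xorUpTo f n) (xorUpTo g n) (f (suc n)) (g (suc n)))

∧-distribˡ-xorUpTo : ∀ c (f : ℕ → Bool) n → c ∧ xorUpTo f n ≡ xorUpTo (λ i → c ∧ f i) n
∧-distribˡ-xorUpTo c f zero    = refl
∧-distribˡ-xorUpTo c f (suc n) =
  trans (∧-distribˡ-xor c (xorUpTo f n) (f (suc n)))
        (cong (_xor (c ∧ f (suc n))) (∧-distribˡ-xorUpTo c f n))

∧-distribʳ-xorUpTo : ∀ c (f : ℕ → Bool) n → xorUpTo f n ∧ c ≡ xorUpTo (λ i → f i ∧ c) n
∧-distribʳ-xorUpTo c f zero    = refl
∧-distribʳ-xorUpTo c f (suc n) =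
  trans (∧-distribʳ-xor c (xorUpTo f n) (f (suc n)))
        (cong (_xor (f (suc n) ∧ c)) (∧-distribʳ-xorUpTo c f n))

xorUpTo-suc : ∀ (f : ℕ → Bool) n → xorUpTo f (suc n) ≡ f 0 xor xorUpTo (f ∘ suc) n
xorUpTo-suc f zero    = refl
xorUpTo-suc f (suc n) =
  trans (cong (_xor f (suc (suc n))) (xorUpTo-suc f n)) (xor-assoc (f 0) _ _)

xorUpTo-triangle : ∀ (F : ℕ → ℕ → Bool) n →
  xorUpTo (λ i → xorUpTo (λ j → F j i) i) n ≡ xorUpTo (λ j → xorUpTo (λ k → F j (j + k)) (n ∸ j)) n
xorUpTo-triangle F zero    = refl
xorUpTo-triangle F (suc n) = begin
    xorUpTo (λ i → xorUpTo (λ j → F j i) i) n xor xorUpTo (λ j → F j (suc n)) (suc n)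
  ≡⟨ cong (_xor xorUpTo (λ j → F j (suc n)) (suc n)) (xorUpTo-triangle F n) ⟩
    rows n xor (xorUpTo (λ j → F j (suc n)) n xor F (suc n) (suc n))
  ≡⟨ sym (xor-assoc (rows n) _ _) ⟩
    (rows n xor xorUpTo (λ j → F j (suc n)) n) xor F (suc n) (suc n)
  ≡⟨ cong₂ _xor_ (sym (xorUpTo-xor _ _ n)) (cong (F (suc n)) (sym (+-identityʳ (suc n)))) ⟩
    xorUpTo (λ j → xorUpTo (λ k → F j (j + k)) (n ∸ j) xor F j (suc n)) n
      xor F (suc n) (suc n + 0)
  ≡⟨ cong₂ _xor_ (xorUpTo-cong n extend-row)
                 (cong (xorUpTo (λ k → F (suc n) (suc n + k))) (sym (n∸n≡0 n))) ⟩
    xorUpTo (λ j → xorUpTo (λ k → F j (j + k)) (suc n ∸ j)) n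
      xor xorUpTo (λ k → F (suc n) (suc n + k)) (n ∸ n)
  ∎
  where
  open ≡-Reasoning
  rows : ℕ → Bool
  rows m = xorUpTo (λ j → xorUpTo (λ k → F j (j + k)) (m ∸ j)) m
  extend-row : ∀ j → j ≤ n → xorUpTo (λ k → F j (j + k)) (n ∸ j) xor F j (suc n)
                           ≡ xorUpTo (λ k → F j (j + k)) (suc n ∸ j)
  extend-row j j≤n rewrite +-∸-assoc 1 j≤n =
    cong (λ m → xorUpTo (λ k → F j (j + k)) (n ∸ j) xor F j m)
         (sym (trans (+-suc j (n ∸ j)) (cong suc (m+[n∸m]≡n j≤n))))

xorUpTo-constS-∧ : ∀ c (f : ℕ → Bool) n → xorUpTo (λ i → constS c i ∧ f i) n ≡ c ∧ f 0
xorUpTo-constS-∧ c f zero    = refl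
xorUpTo-constS-∧ c f (suc n) = trans (xor-identityʳ _) (xorUpTo-constS-∧ c f n)

xor≡false⇒≡ : ∀ {a b} → a xor b ≡ false → a ≡ b
xor≡false⇒≡ {false} a⊕b≡0 = sym a⊕b≡0
xor≡false⇒≡ {true} {true} _ = refl

xor-cancelʳ : ∀ a x → (a xor x) xor a ≡ x
xor-cancelʳ a x =
  trans (cong (_xor a) (xor-comm a x))
        (trans (xor-assoc x a a) (trans (cong (x xor_) (xor-same a)) (xor-identityʳ x)))

⊛-congʳ : ∀ f {g g'} → g ≗ g' → (f ⊛ g) ≗ (f ⊛ g')
⊛-congʳ f g≗g' n = xorUpTo-cong n (λ i _ → cong (f i ∧_) (g≗g' (n ∸ i)))

⊛-assoc : ∀ f g h → ((f ⊛ g) ⊛ h) ≗ (f ⊛ (g ⊛ h))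
⊛-assoc f g h n = begin
    xorUpTo (λ i → xorUpTo (λ j → f j ∧ g (i ∸ j)) i ∧ h (n ∸ i)) n
  ≡⟨ xorUpTo-cong n (λ i _ → ∧-distribʳ-xorUpTo (h (n ∸ i)) (λ j → f j ∧ g (i ∸ j)) i) ⟩
    xorUpTo (λ i → xorUpTo (λ j → (f j ∧ g (i ∸ j)) ∧ h (n ∸ i)) i) n
  ≡⟨ xorUpTo-triangle (λ j i → (f j ∧ g (i ∸ j)) ∧ h (n ∸ i)) n ⟩
    xorUpTo (λ j → xorUpTo (λ k → (f j ∧ g (j + k ∸ j)) ∧ h (n ∸ (j + k))) (n ∸ j)) n
  ≡⟨ xorUpTo-cong n (λ j _ → xorUpTo-cong (n ∸ j) (λ k _ → reindex j k)) ⟩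
    xorUpTo (λ j → xorUpTo (λ k → f j ∧ (g k ∧ h (n ∸ j ∸ k))) (n ∸ j)) n
  ≡⟨ xorUpTo-cong n (λ j _ → sym (∧-distribˡ-xorUpTo (f j) (λ k → g k ∧ h (n ∸ j ∸ k)) (n ∸ j))) ⟩
    xorUpTo (λ j → f j ∧ xorUpTo (λ k → g k ∧ h (n ∸ j ∸ k)) (n ∸ j)) n
  ∎
  where
  open ≡-Reasoning
  reindex : ∀ j k → (f j ∧ g (j + k ∸ j)) ∧ h (n ∸ (j + k)) ≡ f j ∧ (g k ∧ h (n ∸ j ∸ k))
  reindex j k rewrite m+n∸m≡n j k | sym (∸-+-assoc n j k) = ∧-assoc (f j) (g k) _

⊛-distribʳ-⊕ : ∀ f g h → ((f ⊕ g) ⊛ h) ≗ (f ⊛ h ⊕ g ⊛ h)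
⊛-distribʳ-⊕ f g h n =
  trans (xorUpTo-cong n (λ i _ → ∧-distribʳ-xor (h (n ∸ i)) (f i) (g i))) (xorUpTo-xor _ _ n)

⊛-identityˡ : ∀ g → (constS true ⊛ g) ≗ g
⊛-identityˡ g n = xorUpTo-constS-∧ true (λ i → g (n ∸ i)) n

X∘suc≗constS : ∀ i → X (suc i) ≡ constS true i
X∘suc≗constS zero    = refl
X∘suc≗constS (suc i) = refl

X⊛-suc : ∀ g n → (X ⊛ g) (suc n) ≡ g n
X⊛-suc g n = begin
    (X ⊛ g) (suc n)
  ≡⟨ xorUpTo-suc (λ i → X i ∧ g (suc n ∸ i)) n ⟩
    xorUpTo (λ i → X (suc i) ∧ g (n ∸ i)) n
  ≡⟨ xorUpTo-cong n (λ i _ → cong (_∧ g (n ∸ i)) (X∘suc≗constS i)) ⟩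
    (constS true ⊛ g) n
  ≡⟨ ⊛-identityˡ g n ⟩
    g n
  ∎
  where open ≡-Reasoning

powS-+ : ∀ f a b → powS f (a + b) ≗ (powS f a ⊛ powS f b)
powS-+ f zero    b n = sym (⊛-identityˡ (powS f b) n)
powS-+ f (suc a) b n =
  trans (⊛-congʳ f (powS-+ f a b) n) (sym (⊛-assoc f (powS f a) (powS f b) n))

powS-X⊛-< : ∀ m g {n} → n < m → (powS X m ⊛ g) n ≡ false
powS-X⊛-< (suc m) g {zero}  _          = ⊛-assoc X (powS X m) g 0
powS-X⊛-< (suc m) g {suc n} (s≤s n<m) =
  trans (⊛-assoc X (powS X m) g (suc n)) (trans (X⊛-suc (powS X m ⊛ g) n) (powS-X⊛-< m g n<m))

powS-X⊛-+ : ∀ m g n → (powS X m ⊛ g) (m + n) ≡ g n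
powS-X⊛-+ zero    g n = ⊛-identityˡ g n
powS-X⊛-+ (suc m) g n =
  trans (⊛-assoc X (powS X m) g (suc (m + n))) (trans (X⊛-suc (powS X m ⊛ g) (m + n)) (powS-X⊛-+ m g n))

polyS-≥length : ∀ cs n → length cs ≤ n → polyS cs n ≡ false
polyS-≥length []       n       _          = refl
polyS-≥length (c ∷ cs) (suc n) (s≤s len≤n) = trans (X⊛-suc (polyS cs) n) (polyS-≥length cs n len≤n)

⊛-self-suc-suc : ∀ g n → (g ⊛ g) (suc (suc n)) ≡ ((g ∘ suc) ⊛ (g ∘ suc)) n
⊛-self-suc-suc g n = begin
    xorUpTo h (suc n) xor h (suc (suc n))
  ≡⟨ cong₂ _xor_ (xorUpTo-suc h n)
                 (trans (cong (λ m → g (suc (suc n)) ∧ g m) (n∸n≡0 n)) (∧-comm (g (suc (suc n))) (g 0))) ⟩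
    (h 0 xor xorUpTo (h ∘ suc) n) xor h 0
  ≡⟨ xor-cancelʳ (h 0) _ ⟩
    xorUpTo (h ∘ suc) n
  ≡⟨ xorUpTo-cong n (λ i i≤n → cong (λ m → g (suc i) ∧ g m) (+-∸-assoc 1 i≤n)) ⟩
    ((g ∘ suc) ⊛ (g ∘ suc)) n
  ∎
  where
  open ≡-Reasoning
  h : ℕ → Bool
  h i = g i ∧ g (suc (suc n) ∸ i)

⊛-self-even : ∀ k g → (g ⊛ g) (k + k) ≡ g k
⊛-self-even zero    g = ∧-idem (g 0)
⊛-self-even (suc k) g rewrite +-suc k k = trans (⊛-self-suc-suc g (k + k)) (⊛-self-even k (g ∘ suc))

⊛-self-odd : ∀ k g → (g ⊛ g) (suc (k + k)) ≡ false
⊛-self-odd zero    g = trans (cong ((g 0 ∧ g 1) xor_) (∧-comm (g 1) (g 0))) (xor-same (g 0 ∧ g 1))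
⊛-self-odd (suc k) g rewrite +-suc k k = trans (⊛-self-suc-suc g (suc (k + k))) (⊛-self-odd k (g ∘ suc))

even-or-odd : ∀ n → ∃[ k ] (n ≡ k + k ⊎ n ≡ suc (k + k))
even-or-odd zero = 0 , inj₁ refl
even-or-odd (suc n) with even-or-odd n
... | k , inj₁ n≡2k   = k , inj₂ (cong suc n≡2k)
... | k , inj₂ n≡2k+1 = suc k , inj₁ (cong suc (trans n≡2k+1 (sym (+-suc k k))))

-- Series supported on the multiples of m

SupportedOnMultiplesOf : ℕ → Series → Set
SupportedOnMultiplesOf m f = ∀ n → ¬ m ∣ n → f n ≡ false

supported-resp-≗ : ∀ {m f g} → f ≗ g → SupportedOnMultiplesOf m f → SupportedOnMultiplesOf m g
supported-resp-≗ f≗g supp n m∤n = trans (sym (f≗g n)) (supp n m∤n)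

supported-constS : ∀ m c → SupportedOnMultiplesOf m (constS c)
supported-constS m c zero    m∤0 = contradiction (m ∣0) m∤0
supported-constS m c (suc n) _   = refl

supported-⊕ : ∀ {m f g} → SupportedOnMultiplesOf m f → SupportedOnMultiplesOf m g →
              SupportedOnMultiplesOf m (f ⊕ g)
supported-⊕ supp-f supp-g n m∤n = cong₂ _xor_ (supp-f n m∤n) (supp-g n m∤n)

supported-⊛ : ∀ {m f g} → SupportedOnMultiplesOf m f → SupportedOnMultiplesOf m g →
              SupportedOnMultiplesOf m (f ⊛ g)
supported-⊛ {m} {f} {g} supp-f supp-g n m∤n = xorUpTo-false n term≡0
  where
  term≡0 : ∀ i → i ≤ n → f i ∧ g (n ∸ i) ≡ false
  term≡0 i i≤n with m ∣? i
  ... | no m∤i = cong (_∧ g (n ∸ i)) (supp-f i m∤i)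
  ... | yes m∣i = trans (cong (f i ∧_) (supp-g (n ∸ i) m∤n∸i)) (∧-zeroʳ (f i))
    where
    m∤n∸i : ¬ m ∣ n ∸ i
    m∤n∸i m∣n∸i = m∤n (subst (m ∣_) (m∸n+n≡m i≤n) (∣m∣n⇒∣m+n m∣n∸i m∣i))

supported-evalPoly : ∀ {m S} cs → SupportedOnMultiplesOf m S → SupportedOnMultiplesOf m (evalPoly cs S)
supported-evalPoly []       supp n _ = refl
supported-evalPoly {m} (c ∷ cs) supp =
  supported-⊕ (supported-constS m c) (supported-⊛ supp (supported-evalPoly cs supp))

supported-evalPoly2 : ∀ {m A B} rs → SupportedOnMultiplesOf m A → SupportedOnMultiplesOf m B →
                      SupportedOnMultiplesOf m (evalPoly2 rs A B)
supported-evalPoly2 []       supp-A supp-B n _ = refl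
supported-evalPoly2 (r ∷ rs) supp-A supp-B =
  supported-⊕ (supported-evalPoly r supp-B) (supported-⊛ supp-A (supported-evalPoly2 rs supp-A supp-B))

supported-square : ∀ {m g} → SupportedOnMultiplesOf m g → SupportedOnMultiplesOf (2 * m) (g ⊛ g)
supported-square {m} {g} supp n 2m∤n with even-or-odd n
... | k , inj₂ refl = ⊛-self-odd k g
... | k , inj₁ refl = trans (⊛-self-even k g) (supp k m∤k)
  where
  m∤k : ¬ m ∣ k
  m∤k m∣k = 2m∤n (subst (2 * m ∣_) (cong (k +_) (+-identityʳ k)) (*-monoʳ-∣ 2 m∣k))

supported-powS-2^ : ∀ f l → SupportedOnMultiplesOf (2 ^ l) (powS f (2 ^ l))
supported-powS-2^ f zero    n 1∤n = contradiction (1∣ n) 1∤n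
supported-powS-2^ f (suc l) = supported-resp-≗ square≗ (supported-square (supported-powS-2^ f l))
  where
  square≗ : (powS f (2 ^ l) ⊛ powS f (2 ^ l)) ≗ powS f (2 ^ suc l)
  square≗ n = sym (trans (cong (λ k → powS f (2 ^ l + k) n) (+-identityʳ (2 ^ l)))
                         (powS-+ f (2 ^ l) (2 ^ l) n))

-- Progressions on which s vanishes

progression-+-next : ∀ {c d M} k → c + d ≡ M → c + k * M + d ≡ suc k * M
progression-+-next {c} {d} {M} k c+d≡M =
  trans (rearrange c (k * M) d) (cong (_+ k * M) c+d≡M)
  where
  rearrange : ∀ a b e → a + b + e ≡ a + e + b
  rearrange = solve-∀

∤-progression : ∀ {q c d M} k → q ∣ M → ¬ q ∣ d → c + d ≡ M → ¬ q ∣ c + k * M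
∤-progression {q} {c} {d} {M} k q∣M q∤d c+d≡M q∣n =
  q∤d (∣m+n∣m⇒∣n (subst (q ∣_) (sym (progression-+-next {c} {d} k c+d≡M)) (∣-trans q∣M (n∣m*n (suc k)))) q∣n)

2∤1 : ¬ 2 ∣ 1
2∤1 = from-no (2 ∣? 1)

2∤3 : ¬ 2 ∣ 3
2∤3 = from-no (2 ∣? 3)

vanishes-on-progression-i :
  ∀ {M c} (s A B : Series) (f₀ : List Bool) → 2 ∣ M → c + 2 ≡ M → 1 ≤ c →
  SupportedOnMultiplesOf M A → SupportedOnMultiplesOf 2 B → length f₀ ≤ c →
  (∀ n → (A ⊕ X ⊛ B ⊕ s ⊕ polyS f₀) n ≡ false) →
  ∀ k → s (c + k * M) ≡ false
vanishes-on-progression-i {M} {suc c} s A B f₀ 2∣M c+2≡M (s≤s z≤n) supp-A supp-B deg eqn k = begin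
    s n
  ≡⟨ sym (xor-identityʳ (s n)) ⟩
    ((false xor false) xor s n) xor false
  ≡⟨ sym (cong₂ (λ u v → (u xor s n) xor v) (cong₂ _xor_ A≡0 XB≡0) f₀≡0) ⟩
    ((A n xor (X ⊛ B) n) xor s n) xor polyS f₀ n
  ≡⟨ eqn n ⟩
    false
  ∎
  where
  open ≡-Reasoning
  n = suc c + k * M
  M∤2 : ¬ M ∣ 2
  M∤2 M∣2 = <⇒≱ (subst (2 <_) c+2≡M (s≤s (m≤n+m 2 c))) (∣⇒≤ M∣2)
  A≡0 : A n ≡ false
  A≡0 = supp-A n (∤-progression k ∣-refl M∤2 c+2≡M)
  XB≡0 : (X ⊛ B) n ≡ false
  XB≡0 = trans (X⊛-suc B (c + k * M)) (supp-B _ (∤-progression k 2∣M 2∤3 (trans (+-suc c 2) c+2≡M)))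
  f₀≡0 : polyS f₀ n ≡ false
  f₀≡0 = polyS-≥length f₀ n (≤-trans deg (m≤m+n (suc c) (k * M)))

vanishes-on-progression-ii :
  ∀ {M c} (s A : Series) (f₀ : List Bool) → 2 ∣ M → c + 1 ≡ M →
  SupportedOnMultiplesOf 2 A → length f₀ ≤ c →
  (∀ n → (A ⊕ (powS X M ⊕ constS true) ⊛ s ⊕ polyS f₀) n ≡ false) →
  ∀ k → s (c + k * M) ≡ false
vanishes-on-progression-ii {M} {c} s A f₀ 2∣M c+1≡M supp-A deg eqn = vanish
  where
  open ≡-Reasoning
  recurrence : ∀ k → (powS X M ⊛ s) (c + k * M) ≡ s (c + k * M)
  recurrence k = xor≡false⇒≡ (begin
      (powS X M ⊛ s) n xor s n
    ≡⟨ sym (trans (⊛-distribʳ-⊕ (powS X M) (constS true) s n)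
                  (cong ((powS X M ⊛ s) n xor_) (⊛-identityˡ s n))) ⟩
      ((powS X M ⊕ constS true) ⊛ s) n
    ≡⟨ sym (xor-identityʳ _) ⟩
      (false xor ((powS X M ⊕ constS true) ⊛ s) n) xor false
    ≡⟨ sym (cong₂ (λ u v → (u xor ((powS X M ⊕ constS true) ⊛ s) n) xor v) A≡0 f₀≡0) ⟩
      (A n xor ((powS X M ⊕ constS true) ⊛ s) n) xor polyS f₀ n
    ≡⟨ eqn n ⟩
      false
    ∎)
    where
    n = c + k * M
    A≡0 : A n ≡ false
    A≡0 = supp-A n (∤-progression k 2∣M 2∤1 c+1≡M)
    f₀≡0 : polyS f₀ n ≡ false
    f₀≡0 = polyS-≥length f₀ n (≤-trans deg (m≤m+n c (k * M)))

  vanish : ∀ k → s (c + k * M) ≡ false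
  vanish zero = trans (sym (recurrence 0)) (powS-X⊛-< M s (subst (_< M) (sym (+-identityʳ c)) c<M))
    where
    c<M : c < M
    c<M = subst (c <_) c+1≡M (m<m+n c z<s)
  vanish (suc k) = begin
      s (c + suc k * M)
    ≡⟨ sym (recurrence (suc k)) ⟩
      (powS X M ⊛ s) (c + (M + k * M))
    ≡⟨ cong (powS X M ⊛ s) (+-comm-assoc c M (k * M)) ⟩
      (powS X M ⊛ s) (M + (c + k * M))
    ≡⟨ powS-X⊛-+ M s (c + k * M) ⟩
      s (c + k * M)
    ≡⟨ vanish k ⟩
      false
    ∎
    where
    +-comm-assoc : ∀ a b e → a + (b + e) ≡ b + (a + e)
    +-comm-assoc = solve-∀

≤-maxBelow : ∀ n (f : ℕ → ℕ) {i} → i < n → f i ≤ maxBelow n f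
≤-maxBelow (suc n) f {i} (s≤s i≤n) with m≤n⇒m<n∨m≡n i≤n
... | inj₁ i<n  = ≤-trans (≤-maxBelow n f i<n) (m≤n⊔m (f n) _)
... | inj₂ refl = m≤m⊔n (f i) _

≤-if-true : ∀ {b} {x y : ℕ} → T b → x ≤ (if b then x else y)
≤-if-true {true} _ = ≤-refl

∣corr∣≤W-entry : ∀ s {N a b t} → a < N → b < N → t < N → a + t * suc b < N →
                 ℤ.∣ corr s a (suc b) (suc t) ∣ ≤ W s N
∣corr∣≤W-entry s {N} a<N b<N t<N in-range =
  ≤-trans (≤-if-true (<⇒<ᵇ in-range))
    (≤-trans (≤-maxBelow N _ t<N) (≤-trans (≤-maxBelow N _ b<N) (≤-maxBelow N _ a<N)))

-- A one-term sum does not depend on the difference (which may exceed N), so take difference 1.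
∣corr∣≤W : ∀ s {N a b t} → 0 < b → a + t * b < N → ℤ.∣ corr s a b (suc t) ∣ ≤ W s N
∣corr∣≤W s {N} {a} {suc b} {zero} _ in-range =
  ∣corr∣≤W-entry s {b = 0} {t = 0} (≤-<-trans (m≤m+n a 0) in-range) 0<N 0<N in-range
  where
  0<N : 0 < N
  0<N = ≤-<-trans z≤n in-range
∣corr∣≤W s {N} {a} {suc b} {suc t} _ in-range = ∣corr∣≤W-entry s a<N b<N t<N in-range
  where
  span<N : suc t * suc b < N
  span<N = ≤-<-trans (m≤n+m (suc t * suc b) a) in-range
  a<N : a < N
  a<N = ≤-<-trans (m≤m+n a _) in-range
  b<N : b < N
  b<N = ≤-<-trans (≤-trans (n≤1+n b) (m≤m+n (suc b) _)) span<N
  t<N : suc t < N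
  t<N = ≤-<-trans (m≤m*n (suc t) (suc b)) span<N

corr-false : ∀ s a b t → (∀ j → j < t → s (a + j * b) ≡ false) → corr s a b t ≡ ℤ.+ t
corr-false s a b zero    _      = refl
corr-false s a b (suc t) s≡0 =
  trans (cong₂ ℤ._+_ (corr-false s a b t (λ j j<t → s≡0 j (m<n⇒m<1+n j<t))) (cong sgn (s≡0 t ≤-refl)))
        (cong ℤ.+_ (+-comm t 1))

progression-≤W : ∀ s {N a b t} → 0 < b → (∀ j → j ≤ t → s (a + j * b) ≡ false) → a + t * b < N →
                 suc t ≤ W s N
progression-≤W s {N} {a} {b} {t} 0<b s≡0 in-range =
  subst (_≤ W s N) (cong ℤ.∣_∣ (corr-false s a b (suc t) (λ j j<1+t → s≡0 j (≤-pred j<1+t))))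
        (∣corr∣≤W s {N} {a} {b} {t} 0<b in-range)

≤W-of-vanishing-progression : ∀ s {c e M N} → c + suc e ≡ M → (∀ k → s (c + k * M) ≡ false) →
                              ∀ t → t * M ≤ N + e → t ≤ W s N
≤W-of-vanishing-progression s                 _      _     zero    _      = z≤n
≤W-of-vanishing-progression s {c} {e} {M} {N} c+1+e≡M s≡0 (suc t) tM≤N+e =
  progression-≤W s 0<M (λ j _ → s≡0 j) (+-cancelˡ-< e (c + t * M) N (begin-strict
    e + (c + t * M)       <⟨ n<1+n _ ⟩
    suc (e + (c + t * M)) ≡⟨ rearrange c e (t * M) ⟩
    c + suc e + t * M     ≡⟨ cong (_+ t * M) c+1+e≡M ⟩
    M + t * M             ≤⟨ tM≤N+e ⟩
    N + e                 ≡⟨ +-comm N e ⟩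
    e + N                 ∎))
  where
  open ≤-Reasoning
  0<M : 0 < M
  0<M = subst (0 <_) c+1+e≡M (≤-trans (s≤s z≤n) (m≤n+m (suc e) c))
  rearrange : ∀ a b x → suc (b + (a + x)) ≡ a + suc b + x
  rearrange = solve-∀

W-lower-bound-i : ∀ s ℓ → 2 ≤ ℓ → (f₀ f₁ f₂ : List Bool) → length f₀ ≤ 2 ^ ℓ ∸ 2 →
  (∀ n → (evalPoly f₂ (powS s (2 ^ ℓ)) ⊕ X ⊛ evalPoly f₁ (powS s 2) ⊕ s ⊕ polyS f₀) n ≡ false) →
  ∀ N → (N + 1) /2^ ℓ ≤ W s N
W-lower-bound-i s ℓ@(suc (suc l)) (s≤s (s≤s _)) f₀ f₁ f₂ deg eqn N =
  ≤W-of-vanishing-progression s c+2≡M s≡0 ((N + 1) /2^ ℓ) (m/n*n≤m (N + 1) M {{m^n≢0 2 ℓ}})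
  where
  M = 2 ^ ℓ
  4≤M : 4 ≤ M
  4≤M = *-monoʳ-≤ 2 (*-monoʳ-≤ 2 (m^n>0 2 l))
  c+2≡M : M ∸ 2 + 2 ≡ M
  c+2≡M = m∸n+n≡m (≤-trans (s≤s (s≤s z≤n)) 4≤M)
  s≡0 : ∀ k → s (M ∸ 2 + k * M) ≡ false
  s≡0 = vanishes-on-progression-i s _ _ f₀ (m∣m*n (2 ^ suc l)) c+2≡M (≤-trans (s≤s z≤n) (∸-monoˡ-≤ 2 4≤M))
          (supported-evalPoly f₂ (supported-powS-2^ s ℓ)) (supported-evalPoly f₁ (supported-powS-2^ s 1))
          deg eqn

W-lower-bound-ii : ∀ s ℓ → 1 ≤ ℓ → (f₁ : List (List Bool)) (f₀ : List Bool) → length f₀ ≤ 2 ^ ℓ ∸ 1 →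
  (∀ n → (evalPoly2 f₁ (powS X 2) (powS s 2) ⊕ (powS X (2 ^ ℓ) ⊕ constS true) ⊛ s ⊕ polyS f₀) n ≡ false) →
  ∀ N → N /2^ ℓ ≤ W s N
W-lower-bound-ii s ℓ@(suc l) (s≤s _) f₁ f₀ deg eqn N =
  ≤W-of-vanishing-progression s c+1≡M s≡0 (N /2^ ℓ)
    (≤-trans (m/n*n≤m N M {{m^n≢0 2 ℓ}}) (m≤m+n N 0))
  where
  M = 2 ^ ℓ
  c+1≡M : M ∸ 1 + 1 ≡ M
  c+1≡M = m∸n+n≡m (m^n>0 2 ℓ)
  s≡0 : ∀ k → s (M ∸ 1 + k * M) ≡ false
  s≡0 = vanishes-on-progression-ii s _ f₀ (m∣m*n (2 ^ l)) c+1≡M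
          (supported-evalPoly2 f₁ (supported-powS-2^ X 1) (supported-powS-2^ s 1)) deg eqn

theorem1 :
      ((s : ℕ → Bool) (ℓ : ℕ) → 2 ≤ ℓ → (f₀ f₁ f₂ : List Bool) →
        length f₀ ≤ 2 ^ ℓ ∸ 2 →
        (∀ n → (evalPoly f₂ (powS s (2 ^ ℓ)) ⊕ X ⊛ evalPoly f₁ (powS s 2) ⊕ s ⊕ polyS f₀) n ≡ false) →
        ∀ N → 1 ≤ N → (N + 1) /2^ ℓ ≤ W s N)
    × ((s : ℕ → Bool) (ℓ : ℕ) → 1 ≤ ℓ → (f₁ : List (List Bool)) (f₀ : List Bool) →
        length f₀ ≤ 2 ^ ℓ ∸ 1 →
        (∀ n → (evalPoly2 f₁ (powS X 2) (powS s 2) ⊕ (powS X (2 ^ ℓ) ⊕ constS true) ⊛ s ⊕ polyS f₀) n ≡ false) →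
        ∀ N → 1 ≤ N → N /2^ ℓ ≤ W s N)
theorem1 =
  (λ s ℓ 2≤ℓ f₀ f₁ f₂ deg eqn N _ → W-lower-bound-i s ℓ 2≤ℓ f₀ f₁ f₂ deg eqn N) ,
  (λ s ℓ 1≤ℓ f₁ f₀ deg eqn N _ → W-lower-bound-ii s ℓ 1≤ℓ f₁ f₀ deg eqn N)
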